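{- Let $F(x,y)$ be a polynomial of total degree $2$ with complex coefficients that maps $\mathbf{N}_0^2$ bijectively onto $\mathbf{N}_0$, and write it as \[ F(x,y) = \frac{1}{2}(ax^2 + 2bxy + cy^2) + \frac{1}{2}(dx + ey) + f. \] Then the quadratic form $Q(x,y) = \frac{1}{2}(ax^2 + 2bxy + cy^2)$ is positive-definite on $\mathbf{N}_0^2$, i.e., $Q(x,y) > 0$ for all $(x,y) \in \mathbf{N}_0^2 \setminus \{(0,0)\}$. Moreover, $a \geq 1$ and $c \geq 1$.
   Context: $\mathbf{N}_0 = \{0,1,2,\ldots\}$; $\mathbf{N}_0^2$ is the set of lattice points with nonnegative integer coordinates. -}

module Defs where

open import Level using (Level; _⊔_)
open import Data.Nat using (ℕ)
open import Data.Integer using (+_)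
open import Data.Product using (_×_; _,_)
open import Data.Rational using (ℚ; ½; _/_)
import Data.Rational.Properties as ℚP
open import Algebra.Bundles using (CommutativeRing)
open import Algebra.Morphism.Structures using (module RingMorphisms)
open import Relation.Binary.PropositionalEquality using (_≡_)
import Function.Definitions as FD

ℕ→ℚ : ℕ → ℚ
ℕ→ℚ n = + n / 1

IsBijectionℕ² : (ℕ × ℕ → ℕ) → Set
IsBijectionℕ² g = FD.Bijective _≡_ _≡_ g

module _ {c ℓ : Level} (K : CommutativeRing c ℓ) where
  open CommutativeRing K

  -- ι is a (unital) ring homomorphism ℚ → K, i.e. K is a ℚ-algebra
  -- (for a field K this says exactly that K has characteristic 0; ℂ is an example).
  IsRingHomFromℚ : (ℚ → Carrier) → Set ℓ
  IsRingHomFromℚ ι = RingMorphisms.IsRingHomomorphism ℚP.+-*-rawRing rawRing ι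

  module _ (ι : ℚ → Carrier) where
    ⟦_⟧ : ℕ → Carrier
    ⟦ n ⟧ = ι (ℕ→ℚ n)

    quadPart : (a b c' : Carrier) → ℕ → ℕ → Carrier
    quadPart a b c' x y =
      ι ½ * (a * (⟦ x ⟧ * ⟦ x ⟧) + (b + b) * (⟦ x ⟧ * ⟦ y ⟧) + c' * (⟦ y ⟧ * ⟦ y ⟧))

    polyF : (a b c' d e f : Carrier) → ℕ → ℕ → Carrier
    polyF a b c' d e f x y =
      quadPart a b c' x y + ι ½ * (d * ⟦ x ⟧ + e * ⟦ y ⟧) + f

{-# OPTIONS --safe #-}
-- Finite differences of g on {0,1,2}² show that a, b, c, d, e, f are (images under ι of)
-- integers, and since ι is injective on ℤ (K is not the zero ring) 2g = 2F holds in ℤ.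
-- Along a ray t ↦ t(x, y) the values of 2g form a polynomial in t with leading coefficient
-- 2Q(x, y), so Q ≥ 0 on ℕ². At a zero (x, y) ≠ (0, 0) of Q the partial derivatives of Q in
-- the directions of the positive coordinates of (x, y) vanish (Euler's identity writes Q as a
-- sum of two nonnegative terms). On an axis this gives a = 0 or c = 0, which makes 2g affine
-- on the x- or y-axis; in the interior it makes 2g affine along all rays parallel to (x, y).
-- Either way injectivity and g ≥ 0 make the slope positive, and then a second point is found
-- at which g repeats a value. Finally a = 2Q(1, 0) and c = 2Q(0, 1) are positive integers.

module Submission where

open import Defs
open import Level using (Level)
open import Function using (_∘_)
open import Function.Definitions using (Injective)
open import Data.Nat as ℕ using (ℕ; zero; suc)
import Data.Nat.Properties as ℕP
open import Data.Product using (_×_; _,_; ∃; ∃-syntax; proj₁; proj₂; swap)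
open import Data.Sum using (inj₂)
open import Data.Maybe using (Maybe; just; nothing)
open import Data.Rational using (ℚ)
open import Algebra.Bundles using (CommutativeRing)
open import Algebra.Morphism.Structures using (module RingMorphisms)
open import Relation.Nullary using (¬_; contradiction; yes; no)
open import Relation.Binary.PropositionalEquality using (_≡_)

module IntegerQuadratics where
  open import Relation.Binary.PropositionalEquality
  open import Data.Integer
    using (ℤ; +_; -[1+_]; 0ℤ; 1ℤ; -1ℤ; ∣_∣; _+_; _*_; _-_; _<_; _≤_; +≤+; +<+; -≤+; -≤-; -<+)
  import Data.Integer.Properties as ℤP
  open import Data.Integer.Solver using (module +-*-Solver)
  open +-*-Solver using (Polynomial; con; _:+_; _:*_; _:-_; _:=_; solve)

  i≤+∣i∣ : ∀ i → i ≤ + ∣ i ∣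
  i≤+∣i∣ (+ n)    = ℤP.≤-refl
  i≤+∣i∣ -[1+ n ] = -≤+

  0≤i++∣i∣ : ∀ i → 0ℤ ≤ i + + ∣ i ∣
  0≤i++∣i∣ (+ n)    = +≤+ ℕ.z≤n
  0≤i++∣i∣ -[1+ n ] = ℤP.≤-reflexive (sym (ℤP.+-inverseˡ (+ suc n)))

  i<0⇒i≤-1 : ∀ {i} → i < 0ℤ → i ≤ -1ℤ
  i<0⇒i≤-1 { -[1+ n ]} _       = -≤- ℕ.z≤n
  i<0⇒i≤-1 {+ n}       (+<+ ())

  0≤i⇒0≤j⇒0≤i*j : ∀ {i j} → 0ℤ ≤ i → 0ℤ ≤ j → 0ℤ ≤ i * j
  0≤i⇒0≤j⇒0≤i*j {+ m} {+ n} _ _ = subst (0ℤ ≤_) (ℤP.pos-* m n) (+≤+ ℕ.z≤n)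

  0≤i⇒0≤j⇒i+j≡0⇒i≡0×j≡0 : ∀ {i j} → 0ℤ ≤ i → 0ℤ ≤ j → i + j ≡ 0ℤ → i ≡ 0ℤ × j ≡ 0ℤ
  0≤i⇒0≤j⇒i+j≡0⇒i≡0×j≡0 {+ m} {+ n} _ _ eq =
    cong +_ (ℕP.m+n≡0⇒m≡0 m m+n≡0) , cong +_ (ℕP.m+n≡0⇒n≡0 m m+n≡0)
    where m+n≡0 = ℤP.+-injective eq

  0<i⇒∣i∣≢0 : ∀ {i} → 0ℤ < i → ∣ i ∣ ≢ 0
  0<i⇒∣i∣≢0 {+ suc n} _ ()
  0<i⇒∣i∣≢0 {+ zero}  (+<+ ())

  [1+n]*i≡0⇒i≡0 : ∀ n {i} → + suc n * i ≡ 0ℤ → i ≡ 0ℤ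
  [1+n]*i≡0⇒i≡0 n eq with ℤP.i*j≡0⇒i≡0∨j≡0 (+ suc n) eq
  ... | inj₂ i≡0 = i≡0

  pos-affine : ∀ u t x → + (u ℕ.+ t ℕ.* x) ≡ + u + + t * + x
  pos-affine u t x = cong (_+_ (+ u)) (ℤP.pos-* t x)

  linear-eventually-neg : ∀ {s} → s < 0ℤ → ∀ c → ∃[ t ] c + + t * s < 0ℤ
  linear-eventually-neg {s} s<0 c = t , (begin-strict
    c + + t * s     ≤⟨ ℤP.+-mono-≤ (i≤+∣i∣ c) (ℤP.*-monoˡ-≤-nonNeg (+ t) (i<0⇒i≤-1 s<0)) ⟩
    γ + + t * -1ℤ   ≡⟨ solve 1 (λ γ → γ :+ (con 1ℤ :+ γ) :* con -1ℤ := con -1ℤ) refl γ ⟩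
    -1ℤ             <⟨ -<+ ⟩
    0ℤ              ∎)
    where
    open ℤP.≤-Reasoning
    t = suc ∣ c ∣
    γ = + ∣ c ∣

  quadratic-eventually-neg : ∀ {a} → a < 0ℤ → ∀ b c → ∃[ t ] c + + t * (b + + t * a) < 0ℤ
  quadratic-eventually-neg {a} a<0 b c = t , (begin-strict
    c + + t * (b + + t * a)
      ≤⟨ ℤP.+-mono-≤ (i≤+∣i∣ c) (ℤP.*-monoˡ-≤-nonNeg (+ t)
           (ℤP.+-mono-≤ (i≤+∣i∣ b) (ℤP.*-monoˡ-≤-nonNeg (+ t) (i<0⇒i≤-1 a<0)))) ⟩
    γ + + t * (β + + t * -1ℤ)
      ≡⟨ solve 2 (λ β γ → γ :+ (con 1ℤ :+ β :+ γ) :* (β :+ (con 1ℤ :+ β :+ γ) :* con -1ℤ)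
                          := con -1ℤ :- (β :+ γ :+ β :* γ :+ γ :* γ)) refl β γ ⟩
    -1ℤ - (β + γ + β * γ + γ * γ)
      ≡⟨ cong₂ (λ p q → -1ℤ - (β + γ + p + q)) (sym (ℤP.pos-* m n)) (sym (ℤP.pos-* n n)) ⟩
    -1ℤ - + (m ℕ.+ n ℕ.+ m ℕ.* n ℕ.+ n ℕ.* n)
      ≤⟨ ℤP.i-j≤i -1ℤ (+ (m ℕ.+ n ℕ.+ m ℕ.* n ℕ.+ n ℕ.* n)) ⟩
    -1ℤ <⟨ -<+ ⟩
    0ℤ ∎)
    where
    open ℤP.≤-Reasoning
    m = ∣ b ∣
    n = ∣ c ∣
    β = + m
    γ = + n
    t = suc (m ℕ.+ n)

  nonneg-affine⇒0≤slope : ∀ c {s} → (∀ t → 0ℤ ≤ c + + t * s) → 0ℤ ≤ s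
  nonneg-affine⇒0≤slope c nonneg = ℤP.≮⇒≥ λ s<0 →
    let t , c+ts<0 = linear-eventually-neg s<0 c in
    ℤP.<⇒≱ c+ts<0 (nonneg t)

  affine-slope-pos : ∀ (φ : ℕ → ℤ) {s} → (∀ t → 0ℤ ≤ φ t) → φ 1 ≢ φ 0 →
                     (∀ t → φ t ≡ φ 0 + + t * s) → 0ℤ < s
  affine-slope-pos φ {s} φ≥0 φ1≢φ0 φ-affine =
    ℤP.≤∧≢⇒< (nonneg-affine⇒0≤slope (φ 0) (λ t → subst (0ℤ ≤_) (φ-affine t) (φ≥0 t))) 0≢s
    where
    0≢s : 0ℤ ≢ s
    0≢s refl = φ1≢φ0 (trans (φ-affine 1) (ℤP.+-identityʳ (φ 0)))

  quadForm : (A B C x y : ℤ) → ℤ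
  quadForm A B C x y = A * (x * x) + + 2 * B * (x * y) + C * (y * y)

  twicePoly : (A B C D E f x y : ℤ) → ℤ
  twicePoly A B C D E f x y = quadForm A B C x y + D * x + E * y + + 2 * f

  -- Half the partial derivatives of quadForm A B C at (x, y).
  ∂ₓ : (A B x y : ℤ) → ℤ
  ∂ₓ A B x y = A * x + B * y

  ∂ᵧ : (B C x y : ℤ) → ℤ
  ∂ᵧ B C x y = B * x + C * y

  private
    quadFormₚ : ∀ {n} → (A B C x y : Polynomial n) → Polynomial n
    quadFormₚ A B C x y = A :* (x :* x) :+ con (+ 2) :* B :* (x :* y) :+ C :* (y :* y)

    twicePolyₚ : ∀ {n} → (A B C D E f x y : Polynomial n) → Polynomial n
    twicePolyₚ A B C D E f x y = quadFormₚ A B C x y :+ D :* x :+ E :* y :+ con (+ 2) :* f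

  quadForm-euler : ∀ A B C x y → quadForm A B C x y ≡ x * ∂ₓ A B x y + y * ∂ᵧ B C x y
  quadForm-euler = solve 5 (λ A B C x y →
    quadFormₚ A B C x y := x :* (A :* x :+ B :* y) :+ y :* (B :* x :+ C :* y)) refl

  quadForm-ray-from-x : ∀ A B C t x y →
    quadForm A B C (1ℤ + t * x) (t * y) ≡ A + t * (+ 2 * ∂ₓ A B x y + t * quadForm A B C x y)
  quadForm-ray-from-x = solve 6 (λ A B C t x y →
    quadFormₚ A B C (con 1ℤ :+ t :* x) (t :* y)
      := A :+ t :* (con (+ 2) :* (A :* x :+ B :* y) :+ t :* quadFormₚ A B C x y)) refl

  quadForm-ray-from-y : ∀ A B C t x y →
    quadForm A B C (t * x) (1ℤ + t * y) ≡ C + t * (+ 2 * ∂ᵧ B C x y + t * quadForm A B C x y)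
  quadForm-ray-from-y = solve 6 (λ A B C t x y →
    quadFormₚ A B C (t :* x) (con 1ℤ :+ t :* y)
      := C :+ t :* (con (+ 2) :* (B :* x :+ C :* y) :+ t :* quadFormₚ A B C x y)) refl

  twicePoly-ray : ∀ A B C D E f u v t x y →
    twicePoly A B C D E f (u + t * x) (v + t * y) ≡
    twicePoly A B C D E f u v +
      t * (D * x + E * y + + 2 * (u * ∂ₓ A B x y + v * ∂ᵧ B C x y) + t * quadForm A B C x y)
  twicePoly-ray = solve 11 (λ A B C D E f u v t x y →
    twicePolyₚ A B C D E f (u :+ t :* x) (v :+ t :* y)
      := twicePolyₚ A B C D E f u v
         :+ t :* (D :* x :+ E :* y :+ con (+ 2) :* (u :* (A :* x :+ B :* y) :+ v :* (B :* x :+ C :* y))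
                  :+ t :* quadFormₚ A B C x y)) refl

  twicePoly-swap : ∀ A B C D E f x y → twicePoly A B C D E f y x ≡ twicePoly C B A E D f x y
  twicePoly-swap = solve 8 (λ A B C D E f x y →
    twicePolyₚ A B C D E f y x := twicePolyₚ C B A E D f x y) refl

  quadForm-e₁ : ∀ A B C → quadForm A B C 1ℤ 0ℤ ≡ A
  quadForm-e₁ = solve 3 (λ A B C → quadFormₚ A B C (con 1ℤ) (con 0ℤ) := A) refl

  quadForm-e₂ : ∀ A B C → quadForm A B C 0ℤ 1ℤ ≡ C
  quadForm-e₂ = solve 3 (λ A B C → quadFormₚ A B C (con 0ℤ) (con 1ℤ) := C) refl

  ∂ₓ-on-x-axis : ∀ A B x → ∂ₓ A B x 0ℤ ≡ x * A
  ∂ₓ-on-x-axis = solve 3 (λ A B x → A :* x :+ B :* con 0ℤ := x :* A) refl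

  ∂ᵧ-on-y-axis : ∀ B C y → ∂ᵧ B C 0ℤ y ≡ y * C
  ∂ᵧ-on-y-axis = solve 3 (λ B C y → B :* con 0ℤ :+ C :* y := y :* C) refl

  module NonNegativeForm (A B C : ℤ) (nonneg : ∀ x y → 0ℤ ≤ quadForm A B C (+ x) (+ y)) where

    Q : ℕ → ℕ → ℤ
    Q x y = quadForm A B C (+ x) (+ y)

    private
      0≤2i⇒0≤i : ∀ {i} → 0ℤ ≤ + 2 * i → 0ℤ ≤ i
      0≤2i⇒0≤i {i} = ℤP.*-cancelˡ-≤-pos 0ℤ i (+ 2)

      no-curvature : ∀ c s t → c + t * (s + t * 0ℤ) ≡ c + t * s
      no-curvature = solve 3 (λ c s t → c :+ t :* (s :+ t :* con 0ℤ) := c :+ t :* s) refl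

    Q≡0⇒0≤∂ₓ : ∀ x y → Q x y ≡ 0ℤ → 0ℤ ≤ ∂ₓ A B (+ x) (+ y)
    Q≡0⇒0≤∂ₓ x y Q≡0 = 0≤2i⇒0≤i (nonneg-affine⇒0≤slope A λ t →
      subst (0ℤ ≤_) (along t) (nonneg (1 ℕ.+ t ℕ.* x) (t ℕ.* y)))
      where
      along : ∀ t → Q (1 ℕ.+ t ℕ.* x) (t ℕ.* y) ≡ A + + t * (+ 2 * ∂ₓ A B (+ x) (+ y))
      along t = begin
        Q (1 ℕ.+ t ℕ.* x) (t ℕ.* y)
          ≡⟨ cong₂ (quadForm A B C) (pos-affine 1 t x) (ℤP.pos-* t y) ⟩
        quadForm A B C (1ℤ + + t * + x) (+ t * + y)
          ≡⟨ quadForm-ray-from-x A B C (+ t) (+ x) (+ y) ⟩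
        A + + t * (+ 2 * ∂ₓ A B (+ x) (+ y) + + t * Q x y)
          ≡⟨ cong (λ q → A + + t * (+ 2 * ∂ₓ A B (+ x) (+ y) + + t * q)) Q≡0 ⟩
        A + + t * (+ 2 * ∂ₓ A B (+ x) (+ y) + + t * 0ℤ)
          ≡⟨ no-curvature A _ (+ t) ⟩
        A + + t * (+ 2 * ∂ₓ A B (+ x) (+ y)) ∎
        where open ≡-Reasoning

    Q≡0⇒0≤∂ᵧ : ∀ x y → Q x y ≡ 0ℤ → 0ℤ ≤ ∂ᵧ B C (+ x) (+ y)
    Q≡0⇒0≤∂ᵧ x y Q≡0 = 0≤2i⇒0≤i (nonneg-affine⇒0≤slope C λ t →
      subst (0ℤ ≤_) (along t) (nonneg (t ℕ.* x) (1 ℕ.+ t ℕ.* y)))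
      where
      along : ∀ t → Q (t ℕ.* x) (1 ℕ.+ t ℕ.* y) ≡ C + + t * (+ 2 * ∂ᵧ B C (+ x) (+ y))
      along t = begin
        Q (t ℕ.* x) (1 ℕ.+ t ℕ.* y)
          ≡⟨ cong₂ (quadForm A B C) (ℤP.pos-* t x) (pos-affine 1 t y) ⟩
        quadForm A B C (+ t * + x) (1ℤ + + t * + y)
          ≡⟨ quadForm-ray-from-y A B C (+ t) (+ x) (+ y) ⟩
        C + + t * (+ 2 * ∂ᵧ B C (+ x) (+ y) + + t * Q x y)
          ≡⟨ cong (λ q → C + + t * (+ 2 * ∂ᵧ B C (+ x) (+ y) + + t * q)) Q≡0 ⟩
        C + + t * (+ 2 * ∂ᵧ B C (+ x) (+ y) + + t * 0ℤ)
          ≡⟨ no-curvature C _ (+ t) ⟩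
        C + + t * (+ 2 * ∂ᵧ B C (+ x) (+ y)) ∎
        where open ≡-Reasoning

    A≡0⇒0≤B : A ≡ 0ℤ → 0ℤ ≤ B
    A≡0⇒0≤B A≡0 = subst (0ℤ ≤_) ∂ᵧ-at-e₁ (Q≡0⇒0≤∂ᵧ 1 0 (trans (quadForm-e₁ A B C) A≡0))
      where
      ∂ᵧ-at-e₁ : ∂ᵧ B C 1ℤ 0ℤ ≡ B
      ∂ᵧ-at-e₁ = solve 2 (λ B C → B :* con 1ℤ :+ C :* con 0ℤ := B) refl B C

    -- Euler's identity writes Q x y as a sum of two nonnegative terms.
    Q≡0⇒x∂ₓ≡0×y∂ᵧ≡0 : ∀ x y → Q x y ≡ 0ℤ →
      + x * ∂ₓ A B (+ x) (+ y) ≡ 0ℤ × + y * ∂ᵧ B C (+ x) (+ y) ≡ 0ℤ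
    Q≡0⇒x∂ₓ≡0×y∂ᵧ≡0 x y Q≡0 = 0≤i⇒0≤j⇒i+j≡0⇒i≡0×j≡0
      (0≤i⇒0≤j⇒0≤i*j (ℤP.nonNegative⁻¹ (+ x)) (Q≡0⇒0≤∂ₓ x y Q≡0))
      (0≤i⇒0≤j⇒0≤i*j (ℤP.nonNegative⁻¹ (+ y)) (Q≡0⇒0≤∂ᵧ x y Q≡0))
      (trans (sym (quadForm-euler A B C (+ x) (+ y))) Q≡0)

    Q≡0⇒∂ₓ≡0 : ∀ p y → Q (suc p) y ≡ 0ℤ → ∂ₓ A B (+ suc p) (+ y) ≡ 0ℤ
    Q≡0⇒∂ₓ≡0 p y Q≡0 = [1+n]*i≡0⇒i≡0 p (proj₁ (Q≡0⇒x∂ₓ≡0×y∂ᵧ≡0 (suc p) y Q≡0))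

    Q≡0⇒∂ᵧ≡0 : ∀ x q → Q x (suc q) ≡ 0ℤ → ∂ᵧ B C (+ x) (+ suc q) ≡ 0ℤ
    Q≡0⇒∂ᵧ≡0 x q Q≡0 = [1+n]*i≡0⇒i≡0 q (proj₂ (Q≡0⇒x∂ₓ≡0×y∂ᵧ≡0 x (suc q) Q≡0))

  module QuadraticInjection (g : ℕ × ℕ → ℕ) (g-injective : Injective _≡_ _≡_ g) (A B C D E : ℤ)
    (twice-g : ∀ x y → + 2 * + g (x , y) ≡ twicePoly A B C D E (+ g (0 , 0)) (+ x) (+ y)) where

    -- 2F has integer coefficients, F itself in general does not.
    g₂ : ℕ → ℕ → ℤ
    g₂ x y = + 2 * + g (x , y)

    f₀ : ℤ
    f₀ = + g (0 , 0)

    P : ℤ → ℤ → ℤ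
    P = twicePoly A B C D E f₀

    g₂-nonneg : ∀ x y → 0ℤ ≤ g₂ x y
    g₂-nonneg x y = subst (0ℤ ≤_) (ℤP.pos-* 2 (g (x , y))) (+≤+ ℕ.z≤n)

    g₂-injective : ∀ {x y u v} → g₂ x y ≡ g₂ u v → (x , y) ≡ (u , v)
    g₂-injective eq = g-injective (ℤP.+-injective (ℤP.*-cancelˡ-≡ (+ 2) _ _ eq))

    g₂-ray : ∀ u v t x y → g₂ (u ℕ.+ t ℕ.* x) (v ℕ.+ t ℕ.* y) ≡
      g₂ u v + + t * (D * + x + E * + y + + 2 * (+ u * ∂ₓ A B (+ x) (+ y) + + v * ∂ᵧ B C (+ x) (+ y))
                      + + t * quadForm A B C (+ x) (+ y))
    g₂-ray u v t x y = begin
      g₂ (u ℕ.+ t ℕ.* x) (v ℕ.+ t ℕ.* y)    ≡⟨ twice-g _ _ ⟩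
      P (+ (u ℕ.+ t ℕ.* x)) (+ (v ℕ.+ t ℕ.* y)) ≡⟨ cong₂ P (pos-affine u t x) (pos-affine v t y) ⟩
      P (+ u + + t * + x) (+ v + + t * + y)  ≡⟨ twicePoly-ray A B C D E f₀ (+ u) (+ v) (+ t) (+ x) (+ y) ⟩
      P (+ u) (+ v) + _                      ≡⟨ cong (_+ _) (sym (twice-g u v)) ⟩
      g₂ u v + _                             ∎
      where open ≡-Reasoning

    g₂-ray₀ : ∀ t x y → g₂ (t ℕ.* x) (t ℕ.* y) ≡
      g₂ 0 0 + + t * (D * + x + E * + y + + t * quadForm A B C (+ x) (+ y))
    g₂-ray₀ t x y = trans (g₂-ray 0 0 t x y)
      (solve 6 (λ c l a b t q → c :+ t :* (l :+ con (+ 2) :* (con 0ℤ :* a :+ con 0ℤ :* b) :+ t :* q)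
                               := c :+ t :* (l :+ t :* q))
        refl (g₂ 0 0) (D * + x + E * + y) (∂ₓ A B (+ x) (+ y)) (∂ᵧ B C (+ x) (+ y)) (+ t)
             (quadForm A B C (+ x) (+ y)))

    -- Along a ray with Q < 0 the values of 2g would be a downward parabola.
    quadForm-nonneg : ∀ x y → 0ℤ ≤ quadForm A B C (+ x) (+ y)
    quadForm-nonneg x y = ℤP.≮⇒≥ λ Q<0 →
      let t , lt = quadratic-eventually-neg Q<0 (D * + x + E * + y) (g₂ 0 0) in
      ℤP.<⇒≱ (subst (_< 0ℤ) (sym (g₂-ray₀ t x y)) lt) (g₂-nonneg (t ℕ.* x) (t ℕ.* y))

    open NonNegativeForm A B C quadForm-nonneg public

    g₂-ray-flat : ∀ x y → Q x y ≡ 0ℤ → ∂ₓ A B (+ x) (+ y) ≡ 0ℤ → ∂ᵧ B C (+ x) (+ y) ≡ 0ℤ →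
      ∀ u v t → g₂ (u ℕ.+ t ℕ.* x) (v ℕ.+ t ℕ.* y) ≡ g₂ u v + + t * (D * + x + E * + y)
    g₂-ray-flat x y Q≡0 ∂ₓ≡0 ∂ᵧ≡0 u v t = begin
      g₂ (u ℕ.+ t ℕ.* x) (v ℕ.+ t ℕ.* y)
        ≡⟨ g₂-ray u v t x y ⟩
      g₂ u v + + t * (L + + 2 * (+ u * ∂ₓ A B (+ x) (+ y) + + v * ∂ᵧ B C (+ x) (+ y)) + + t * Q x y)
        ≡⟨ cong₂ (λ a b → g₂ u v + + t * (L + + 2 * (+ u * a + + v * b) + + t * Q x y)) ∂ₓ≡0 ∂ᵧ≡0 ⟩
      g₂ u v + + t * (L + + 2 * (+ u * 0ℤ + + v * 0ℤ) + + t * Q x y)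
        ≡⟨ cong (λ c → g₂ u v + + t * (L + + 2 * (+ u * 0ℤ + + v * 0ℤ) + + t * c)) Q≡0 ⟩
      g₂ u v + + t * (L + + 2 * (+ u * 0ℤ + + v * 0ℤ) + + t * 0ℤ)
        ≡⟨ solve 5 (λ c L u v t → c :+ t :* (L :+ con (+ 2) :* (u :* con 0ℤ :+ v :* con 0ℤ) :+ t :* con 0ℤ)
                               := c :+ t :* L) refl (g₂ u v) L (+ u) (+ v) (+ t) ⟩
      g₂ u v + + t * L ∎
      where
      open ≡-Reasoning
      L = D * + x + E * + y

    -- If A = 0 then 2g is affine with slope D > 0 on the x-axis, while 2g at (t, D)
    -- equals 2g at (u, 0) for u = t + 2Bt + CD + E; choosing t = |CD + E| makes u ≥ 0.
    A≢0 : A ≢ 0ℤ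
    A≢0 refl = 0<i⇒∣i∣≢0 0<D (sym (cong proj₂ (g₂-injective collision)))
      where
      on-x-axis : ∀ t → g₂ t 0 ≡ g₂ 0 0 + + t * D
      on-x-axis t = trans (twice-g t 0)
        (solve 6 (λ B C D E f t → twicePolyₚ (con 0ℤ) B C D E f t (con 0ℤ) := con (+ 2) :* f :+ t :* D)
          refl B C D E f₀ (+ t))
      0<D : 0ℤ < D
      0<D = affine-slope-pos (λ t → g₂ t 0) (λ t → g₂-nonneg t 0)
        (λ eq → contradiction (g₂-injective eq) λ ()) on-x-axis
      d = ∣ D ∣
      +d≡D : + d ≡ D
      +d≡D = ℤP.0≤i⇒+∣i∣≡i (ℤP.<⇒≤ 0<D)
      k = C * D + E
      t = ∣ k ∣
      u₀ = k + + t + + 2 * B * + t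
      +u≡u₀ : + ∣ u₀ ∣ ≡ u₀
      +u≡u₀ = ℤP.0≤i⇒+∣i∣≡i (ℤP.+-mono-≤ (0≤i++∣i∣ k)
        (0≤i⇒0≤j⇒0≤i*j {+ 2 * B} {+ t}
          (0≤i⇒0≤j⇒0≤i*j {+ 2} (+≤+ ℕ.z≤n) (A≡0⇒0≤B refl)) (+≤+ ℕ.z≤n)))
      collision : g₂ ∣ u₀ ∣ 0 ≡ g₂ t d
      collision = begin
        g₂ ∣ u₀ ∣ 0            ≡⟨ on-x-axis ∣ u₀ ∣ ⟩
        g₂ 0 0 + + ∣ u₀ ∣ * D  ≡⟨ cong (λ u → g₂ 0 0 + u * D) +u≡u₀ ⟩
        g₂ 0 0 + u₀ * D        ≡⟨ solve 6 (λ B C D E f t →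
                                    con (+ 2) :* f :+ (C :* D :+ E :+ t :+ con (+ 2) :* B :* t) :* D
                                    := twicePolyₚ (con 0ℤ) B C D E f t D) refl B C D E f₀ (+ t) ⟩
        P (+ t) D              ≡⟨ cong (P (+ t)) (sym +d≡D) ⟩
        P (+ t) (+ d)          ≡⟨ twice-g t d ⟨
        g₂ t d                 ∎
        where open ≡-Reasoning

    -- At an interior zero of Q the gradient of Q vanishes too, so 2g is affine with
    -- slope M > 0 along every ray in that direction; the rays from (0,0) and (0,M)
    -- then meet a common value of 2g.
    no-interior-zero : ∀ p q → quadForm A B C (+ suc p) (+ suc q) ≢ 0ℤ
    no-interior-zero p q Q≡0 = 0<i⇒∣i∣≢0 0<M (ℕP.+-cancelʳ-≡ (t ℕ.* y₀) m 0 (sym y-coords))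
      where
      x₀ = suc p
      y₀ = suc q
      M = D * + x₀ + E * + y₀
      ray : ∀ u v t → g₂ (u ℕ.+ t ℕ.* x₀) (v ℕ.+ t ℕ.* y₀) ≡ g₂ u v + + t * M
      ray = g₂-ray-flat x₀ y₀ Q≡0 (Q≡0⇒∂ₓ≡0 p y₀ Q≡0) (Q≡0⇒∂ᵧ≡0 x₀ q Q≡0)
      0<M : 0ℤ < M
      0<M = affine-slope-pos (λ t → g₂ (t ℕ.* x₀) (t ℕ.* y₀))
        (λ t → g₂-nonneg (t ℕ.* x₀) (t ℕ.* y₀))
        (λ eq → contradiction (cong proj₁ (g₂-injective eq)) λ ()) (ray 0 0)
      m = ∣ M ∣
      +m≡M : + m ≡ M
      +m≡M = ℤP.0≤i⇒+∣i∣≡i (ℤP.<⇒≤ 0<M)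
      k = C * M + E
      t = ∣ k ∣
      s = ∣ k + + t ∣
      +s≡k+t : + s ≡ k + + t
      +s≡k+t = ℤP.0≤i⇒+∣i∣≡i (0≤i++∣i∣ k)
      on-y-axis : g₂ 0 m ≡ g₂ 0 0 + k * M
      on-y-axis = begin
        g₂ 0 m         ≡⟨ twice-g 0 m ⟩
        P 0ℤ (+ m)     ≡⟨ cong (P 0ℤ) +m≡M ⟩
        P 0ℤ M         ≡⟨ solve 7 (λ A B C D E f M → twicePolyₚ A B C D E f (con 0ℤ) M
                                    := con (+ 2) :* f :+ (C :* M :+ E) :* M) refl A B C D E f₀ M ⟩
        g₂ 0 0 + k * M ∎
        where open ≡-Reasoning
      collision : g₂ (s ℕ.* x₀) (s ℕ.* y₀) ≡ g₂ (t ℕ.* x₀) (m ℕ.+ t ℕ.* y₀)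
      collision = begin
        g₂ (s ℕ.* x₀) (s ℕ.* y₀)          ≡⟨ ray 0 0 s ⟩
        g₂ 0 0 + + s * M                  ≡⟨ cong (λ i → g₂ 0 0 + i * M) +s≡k+t ⟩
        g₂ 0 0 + (k + + t) * M            ≡⟨ solve 4 (λ c k t M → c :+ (k :+ t) :* M := c :+ k :* M :+ t :* M)
                                               refl (g₂ 0 0) k (+ t) M ⟩
        g₂ 0 0 + k * M + + t * M          ≡⟨ cong (_+ + t * M) on-y-axis ⟨
        g₂ 0 m + + t * M                  ≡⟨ ray 0 m t ⟨
        g₂ (t ℕ.* x₀) (m ℕ.+ t ℕ.* y₀)    ∎
        where open ≡-Reasoning
      points-equal = g₂-injective collision
      s≡t : s ≡ t
      s≡t = ℕP.*-cancelʳ-≡ s t x₀ (cong proj₁ points-equal)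
      y-coords : 0 ℕ.+ t ℕ.* y₀ ≡ m ℕ.+ t ℕ.* y₀
      y-coords = trans (cong (ℕ._* y₀) (sym s≡t)) (cong proj₂ points-equal)

  module _ (g : ℕ × ℕ → ℕ) (g-injective : Injective _≡_ _≡_ g) (A B C D E : ℤ)
    (twice-g : ∀ x y → + 2 * + g (x , y) ≡ twicePoly A B C D E (+ g (0 , 0)) (+ x) (+ y)) where

    private
      open QuadraticInjection g g-injective A B C D E twice-g
      module Swapped = QuadraticInjection (g ∘ swap) (λ eq → cong swap (g-injective eq)) C B A E D
        (λ x y → trans (twice-g y x) (twicePoly-swap A B C D E (+ g (0 , 0)) (+ x) (+ y)))

      Q≢0 : ∀ x y → ¬ (x ≡ 0 × y ≡ 0) → quadForm A B C (+ x) (+ y) ≢ 0ℤ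
      Q≢0 zero    zero    not-origin _ = not-origin (refl , refl)
      Q≢0 (suc p) zero    _ Q≡0 =
        A≢0 ([1+n]*i≡0⇒i≡0 p (trans (sym (∂ₓ-on-x-axis A B (+ suc p))) (Q≡0⇒∂ₓ≡0 p 0 Q≡0)))
      Q≢0 zero    (suc q) _ Q≡0 =
        Swapped.A≢0 ([1+n]*i≡0⇒i≡0 q (trans (sym (∂ᵧ-on-y-axis B C (+ suc q))) (Q≡0⇒∂ᵧ≡0 0 q Q≡0)))
      Q≢0 (suc p) (suc q) _ = no-interior-zero p q

    quadForm-pos : ∀ x y → ¬ (x ≡ 0 × y ≡ 0) → 0ℤ < quadForm A B C (+ x) (+ y)
    quadForm-pos x y not-origin = ℤP.≤∧≢⇒< (quadForm-nonneg x y) (Q≢0 x y not-origin ∘ sym)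

    1≤A : 1ℤ ≤ A
    1≤A = ℤP.i<j⇒suc[i]≤j (subst (0ℤ <_) (quadForm-e₁ A B C) (quadForm-pos 1 0 λ ()))

    1≤C : 1ℤ ≤ C
    1≤C = ℤP.i<j⇒suc[i]≤j (subst (0ℤ <_) (quadForm-e₂ A B C) (quadForm-pos 0 1 λ ()))

module IntegersInℚ where
  open import Relation.Binary.PropositionalEquality
  open import Data.Integer as ℤ using (ℤ; +_; 0ℤ; 1ℤ)
  import Data.Integer.Properties as ℤP
  open import Data.Integer.Tactic.RingSolver using (solve-∀)
  import Data.Rational as ℚ
  import Data.Rational.Properties as ℚP
  import Data.Rational.Unnormalised as ℚᵘ
  import Data.Rational.Unnormalised.Properties as ℚᵘP
  open import Data.Rational.Literals using (fromℤ) public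

  fromℤ-+ : ∀ m n → fromℤ (m ℤ.+ n) ≡ fromℤ m ℚ.+ fromℤ n
  fromℤ-+ m n = ℚP.toℚᵘ-injective
    (ℚᵘP.≃-trans (ℚᵘ.*≡* (eq m n)) (ℚᵘP.≃-sym (ℚP.toℚᵘ-homo-+ (fromℤ m) (fromℤ n))))
    where
    eq : ∀ m n → (m ℤ.+ n) ℤ.* (1ℤ ℤ.* 1ℤ) ≡ (m ℤ.* 1ℤ ℤ.+ n ℤ.* 1ℤ) ℤ.* 1ℤ
    eq = solve-∀

  fromℤ-* : ∀ m n → fromℤ (m ℤ.* n) ≡ fromℤ m ℚ.* fromℤ n
  fromℤ-* m n = ℚP.toℚᵘ-injective
    (ℚᵘP.≃-trans (ℚᵘ.*≡* (eq m n)) (ℚᵘP.≃-sym (ℚP.toℚᵘ-homo-* (fromℤ m) (fromℤ n))))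
    where
    eq : ∀ m n → (m ℤ.* n) ℤ.* (1ℤ ℤ.* 1ℤ) ≡ (m ℤ.* n) ℤ.* 1ℤ
    eq = solve-∀

  fromℤ-neg : ∀ m → fromℤ (ℤ.- m) ≡ ℚ.- fromℤ m
  fromℤ-neg m = ℚP.toℚᵘ-injective (ℚᵘP.≃-sym (ℚP.toℚᵘ-homo‿- (fromℤ m)))

  fromℤ-injective : ∀ {m n} → fromℤ m ≡ fromℤ n → m ≡ n
  fromℤ-injective = cong ℚ.↥_

  fromℤ-pos : ∀ n → fromℤ (+ n) ≡ ℕ→ℚ n
  fromℤ-pos n = sym (ℚP.↥p/↧p≡p (fromℤ (+ n)))

  fromℤ-mono-< : ∀ {m n} → m ℤ.< n → fromℤ m ℚ.< fromℤ n
  fromℤ-mono-< {m} {n} m<n = ℚ.*<* (subst₂ ℤ._<_ (sym (ℤP.*-identityʳ m)) (sym (ℤP.*-identityʳ n)) m<n)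

  fromℤ-mono-≤ : ∀ {m n} → m ℤ.≤ n → fromℤ m ℚ.≤ fromℤ n
  fromℤ-mono-≤ {m} {n} m≤n = ℚ.*≤* (subst₂ ℤ._≤_ (sym (ℤP.*-identityʳ m)) (sym (ℤP.*-identityʳ n)) m≤n)

module ℚAlgebra {c ℓ : Level} (K : CommutativeRing c ℓ) (ι : ℚ → CommutativeRing.Carrier K)
  (ι-hom : IsRingHomFromℚ K ι) where

  open CommutativeRing K
  open IntegersInℚ
  open IntegerQuadratics using (quadForm; twicePoly)
  open import Data.Integer as ℤ using (ℤ; +_)
  import Data.Integer.Properties as ℤP
  open import Data.Rational as ℚ using (½; 0ℚ; 1ℚ)
  import Data.Rational.Properties as ℚP
  import Algebra.Solver.Ring.AlmostCommutativeRing as ACR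
  import Algebra.Solver.Ring as RingSolver
  open import Relation.Binary.Reasoning.Setoid setoid
  import Relation.Binary.PropositionalEquality as ≡
  private
    module ι = RingMorphisms.IsRingHomomorphism ι-hom

    ι-morphism : ℚP.+-*-rawRing ACR.-Raw-AlmostCommutative⟶ ACR.fromCommutativeRing K
    ι-morphism = record
      { ⟦_⟧ = ι ; +-homo = ι.+-homo ; *-homo = ι.*-homo ; -‿homo = ι.-‿homo
      ; 0-homo = ι.0#-homo ; 1-homo = ι.1#-homo }

    ι-≟ : ∀ p q → Maybe (ι p ≈ ι q)
    ι-≟ p q with p ℚ.≟ q
    ... | yes p≡q = just (reflexive (≡.cong ι p≡q))
    ... | no _    = nothing

  open RingSolver ℚP.+-*-rawRing (ACR.fromCommutativeRing K) ι-morphism ι-≟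
    using (Polynomial; con; _:+_; _:*_; _:-_; _:=_; solve)

  ι-reflects-0 : 1# ≉ 0# → ∀ {r} → ι r ≈ 0# → r ≡ 0ℚ
  ι-reflects-0 1≉0 {r} ιr≈0 with r ℚ.≟ 0ℚ
  ... | yes r≡0 = r≡0
  ... | no r≢0 = contradiction (begin
      1#                ≈⟨ ι.1#-homo ⟨
      ι 1ℚ              ≡⟨ ≡.cong ι (ℚP.*-inverseʳ r) ⟨
      ι (r ℚ.* ℚ.1/ r)  ≈⟨ ι.*-homo r (ℚ.1/ r) ⟩
      ι r * ι (ℚ.1/ r)  ≈⟨ *-congʳ ιr≈0 ⟩
      0# * ι (ℚ.1/ r)   ≈⟨ zeroˡ _ ⟩
      0#                ∎) 1≉0
    where
    instance
      r-nonZero : ℚ.NonZero r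
      r-nonZero = ℚ.≢-nonZero r≢0

  ℤ→K : ℤ → Carrier
  ℤ→K i = ι (fromℤ i)

  two : Carrier
  two = ℤ→K (+ 2)

  ℤ→K-+ : ∀ m n → ℤ→K (m ℤ.+ n) ≈ ℤ→K m + ℤ→K n
  ℤ→K-+ m n = trans (reflexive (≡.cong ι (fromℤ-+ m n))) (ι.+-homo (fromℤ m) (fromℤ n))

  ℤ→K-* : ∀ m n → ℤ→K (m ℤ.* n) ≈ ℤ→K m * ℤ→K n
  ℤ→K-* m n = trans (reflexive (≡.cong ι (fromℤ-* m n))) (ι.*-homo (fromℤ m) (fromℤ n))

  ℤ→K-minus : ∀ m n → ℤ→K (m ℤ.- n) ≈ ℤ→K m - ℤ→K n
  ℤ→K-minus m n = trans (ℤ→K-+ m (ℤ.- n))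
    (+-congˡ (trans (reflexive (≡.cong ι (fromℤ-neg n))) (ι.-‿homo (fromℤ n))))

  ℤ→K-injective : 1# ≉ 0# → ∀ {m n} → ℤ→K m ≈ ℤ→K n → m ≡ n
  ℤ→K-injective 1≉0 {m} {n} eq = ℤP.i-j≡0⇒i≡j m n (fromℤ-injective (ι-reflects-0 1≉0 (begin
    ℤ→K (m ℤ.- n)   ≈⟨ ℤ→K-minus m n ⟩
    ℤ→K m - ℤ→K n   ≈⟨ +-congʳ eq ⟩
    ℤ→K n - ℤ→K n   ≈⟨ -‿inverseʳ (ℤ→K n) ⟩
    0#              ∎)))

  quadFormᴷ : (A B C x y : Carrier) → Carrier
  quadFormᴷ A B C x y = A * (x * x) + two * B * (x * y) + C * (y * y)

  twicePolyᴷ : (A B C D E f x y : Carrier) → Carrier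
  twicePolyᴷ A B C D E f x y = quadFormᴷ A B C x y + D * x + E * y + two * f

  ℤ→K-quadForm : ∀ A B C x y →
    ℤ→K (quadForm A B C x y) ≈ quadFormᴷ (ℤ→K A) (ℤ→K B) (ℤ→K C) (ℤ→K x) (ℤ→K y)
  ℤ→K-quadForm A B C x y = trans (ℤ→K-+ _ _) (+-cong (trans (ℤ→K-+ _ _) (+-cong
    (trans (ℤ→K-* _ _) (*-congˡ (ℤ→K-* x x)))
    (trans (ℤ→K-* _ _) (*-cong (ℤ→K-* _ _) (ℤ→K-* x y)))))
    (trans (ℤ→K-* _ _) (*-congˡ (ℤ→K-* y y))))

  ℤ→K-twicePoly : ∀ A B C D E f x y → ℤ→K (twicePoly A B C D E f x y) ≈
    twicePolyᴷ (ℤ→K A) (ℤ→K B) (ℤ→K C) (ℤ→K D) (ℤ→K E) (ℤ→K f) (ℤ→K x) (ℤ→K y)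
  ℤ→K-twicePoly A B C D E f x y = trans (ℤ→K-+ _ _) (+-cong (trans (ℤ→K-+ _ _) (+-cong
    (trans (ℤ→K-+ _ _) (+-cong (ℤ→K-quadForm A B C x y) (ℤ→K-* D x)))
    (ℤ→K-* E y)))
    (ℤ→K-* (+ 2) f))

  quadFormᴷ-cong : ∀ {A A′ B B′ C C′} x y → A ≈ A′ → B ≈ B′ → C ≈ C′ →
    quadFormᴷ A B C x y ≈ quadFormᴷ A′ B′ C′ x y
  quadFormᴷ-cong x y A≈ B≈ C≈ = +-cong (+-cong (*-congʳ A≈) (*-congʳ (*-congˡ B≈))) (*-congʳ C≈)

  twicePolyᴷ-cong : ∀ {A A′ B B′ C C′ D D′ E E′ f f′} x y → A ≈ A′ → B ≈ B′ → C ≈ C′ →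
    D ≈ D′ → E ≈ E′ → f ≈ f′ → twicePolyᴷ A B C D E f x y ≈ twicePolyᴷ A′ B′ C′ D′ E′ f′ x y
  twicePolyᴷ-cong x y A≈ B≈ C≈ D≈ E≈ f≈ =
    +-cong (+-cong (+-cong (quadFormᴷ-cong x y A≈ B≈ C≈) (*-congʳ D≈)) (*-congʳ E≈)) (*-congˡ f≈)

  private
    polyFₚ : ∀ {n} → (a b c d e f x y : Polynomial n) → Polynomial n
    polyFₚ a b c d e f x y =
      con ½ :* (a :* (x :* x) :+ (b :+ b) :* (x :* y) :+ c :* (y :* y)) :+ con ½ :* (d :* x :+ e :* y) :+ f

    quadFormᴷₚ : ∀ {n} → (A B C x y : Polynomial n) → Polynomial n
    quadFormᴷₚ A B C x y = A :* (x :* x) :+ con (fromℤ (+ 2)) :* B :* (x :* y) :+ C :* (y :* y)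

    twicePolyᴷₚ : ∀ {n} → (A B C D E f x y : Polynomial n) → Polynomial n
    twicePolyᴷₚ A B C D E f x y = quadFormᴷₚ A B C x y :+ D :* x :+ E :* y :+ con (fromℤ (+ 2)) :* f

    at : ∀ {n} → ℕ → Polynomial n
    at k = con (ℕ→ℚ k)

  module Coefficients (1≉0 : 1# ≉ 0#) (a b c' d e f : Carrier) (g : ℕ × ℕ → ℕ)
    (F≈g : ∀ x y → polyF K ι a b c' d e f x y ≈ ι (ℕ→ℚ (g (x , y)))) where

    private
      F : ℕ → ℕ → Carrier
      F = polyF K ι a b c' d e f

      G : ℕ → ℕ → ℤ
      G x y = + g (x , y)

      G≈F : ∀ x y → ℤ→K (G x y) ≈ F x y
      G≈F x y = trans (reflexive (≡.cong ι (fromℤ-pos (g (x , y))))) (sym (F≈g x y))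

      ℤ→K-pos : ∀ n → ℤ→K (+ n) ≡ ι (ℕ→ℚ n)
      ℤ→K-pos n = ≡.cong ι (fromℤ-pos n)

    f₀ A B C D E : ℤ
    f₀ = G 0 0
    A = G 2 0 ℤ.- + 2 ℤ.* G 1 0 ℤ.+ f₀
    B = G 1 1 ℤ.- G 1 0 ℤ.- G 0 1 ℤ.+ f₀
    C = G 0 2 ℤ.- + 2 ℤ.* G 0 1 ℤ.+ f₀
    D = + 2 ℤ.* (G 1 0 ℤ.- f₀) ℤ.- A
    E = + 2 ℤ.* (G 0 1 ℤ.- f₀) ℤ.- C

    ℤ→K-f₀ : ℤ→K f₀ ≈ f
    ℤ→K-f₀ = trans (G≈F 0 0)
      (solve 6 (λ a b c d e f → polyFₚ a b c d e f (at 0) (at 0) := f) refl a b c' d e f)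

    ℤ→K-A : ℤ→K A ≈ a
    ℤ→K-A = begin
      ℤ→K A
        ≈⟨ trans (ℤ→K-+ _ _) (+-congʳ (trans (ℤ→K-minus _ _) (+-congˡ (-‿cong (ℤ→K-* _ _))))) ⟩
      ℤ→K (G 2 0) - two * ℤ→K (G 1 0) + ℤ→K f₀
        ≈⟨ +-cong (+-cong (G≈F 2 0) (-‿cong (*-congˡ (G≈F 1 0)))) (G≈F 0 0) ⟩
      F 2 0 - two * F 1 0 + F 0 0
        ≈⟨ solve 6 (λ a b c d e f → polyFₚ a b c d e f (at 2) (at 0)
                     :- con (fromℤ (+ 2)) :* polyFₚ a b c d e f (at 1) (at 0)
                     :+ polyFₚ a b c d e f (at 0) (at 0) := a) refl a b c' d e f ⟩
      a ∎

    ℤ→K-B : ℤ→K B ≈ b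
    ℤ→K-B = begin
      ℤ→K B
        ≈⟨ trans (ℤ→K-+ _ _) (+-congʳ (trans (ℤ→K-minus _ _) (+-congʳ (ℤ→K-minus _ _)))) ⟩
      ℤ→K (G 1 1) - ℤ→K (G 1 0) - ℤ→K (G 0 1) + ℤ→K f₀
        ≈⟨ +-cong (+-cong (+-cong (G≈F 1 1) (-‿cong (G≈F 1 0))) (-‿cong (G≈F 0 1))) (G≈F 0 0) ⟩
      F 1 1 - F 1 0 - F 0 1 + F 0 0
        ≈⟨ solve 6 (λ a b c d e f → polyFₚ a b c d e f (at 1) (at 1) :- polyFₚ a b c d e f (at 1) (at 0)
                     :- polyFₚ a b c d e f (at 0) (at 1) :+ polyFₚ a b c d e f (at 0) (at 0) := b)
             refl a b c' d e f ⟩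
      b ∎

    ℤ→K-C : ℤ→K C ≈ c'
    ℤ→K-C = begin
      ℤ→K C
        ≈⟨ trans (ℤ→K-+ _ _) (+-congʳ (trans (ℤ→K-minus _ _) (+-congˡ (-‿cong (ℤ→K-* _ _))))) ⟩
      ℤ→K (G 0 2) - two * ℤ→K (G 0 1) + ℤ→K f₀
        ≈⟨ +-cong (+-cong (G≈F 0 2) (-‿cong (*-congˡ (G≈F 0 1)))) (G≈F 0 0) ⟩
      F 0 2 - two * F 0 1 + F 0 0
        ≈⟨ solve 6 (λ a b c d e f → polyFₚ a b c d e f (at 0) (at 2)
                     :- con (fromℤ (+ 2)) :* polyFₚ a b c d e f (at 0) (at 1)
                     :+ polyFₚ a b c d e f (at 0) (at 0) := c) refl a b c' d e f ⟩
      c' ∎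

    ℤ→K-D : ℤ→K D ≈ d
    ℤ→K-D = begin
      ℤ→K D
        ≈⟨ trans (ℤ→K-minus _ _) (+-cong (trans (ℤ→K-* _ _) (*-congˡ (ℤ→K-minus _ _))) (-‿cong ℤ→K-A)) ⟩
      two * (ℤ→K (G 1 0) - ℤ→K f₀) - a
        ≈⟨ +-congʳ (*-congˡ (+-cong (G≈F 1 0) (-‿cong (G≈F 0 0)))) ⟩
      two * (F 1 0 - F 0 0) - a
        ≈⟨ solve 6 (λ a b c d e f → con (fromℤ (+ 2)) :* (polyFₚ a b c d e f (at 1) (at 0)
                     :- polyFₚ a b c d e f (at 0) (at 0)) :- a := d) refl a b c' d e f ⟩
      d ∎

    ℤ→K-E : ℤ→K E ≈ e
    ℤ→K-E = begin
      ℤ→K E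
        ≈⟨ trans (ℤ→K-minus _ _) (+-cong (trans (ℤ→K-* _ _) (*-congˡ (ℤ→K-minus _ _))) (-‿cong ℤ→K-C)) ⟩
      two * (ℤ→K (G 0 1) - ℤ→K f₀) - c'
        ≈⟨ +-congʳ (*-congˡ (+-cong (G≈F 0 1) (-‿cong (G≈F 0 0)))) ⟩
      two * (F 0 1 - F 0 0) - c'
        ≈⟨ solve 6 (λ a b c d e f → con (fromℤ (+ 2)) :* (polyFₚ a b c d e f (at 0) (at 1)
                     :- polyFₚ a b c d e f (at 0) (at 0)) :- c := e) refl a b c' d e f ⟩
      e ∎

    twice-g : ∀ x y → + 2 ℤ.* + g (x , y) ≡ twicePoly A B C D E f₀ (+ x) (+ y)
    twice-g x y = ℤ→K-injective 1≉0 (begin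
      ℤ→K (+ 2 ℤ.* G x y)
        ≈⟨ trans (ℤ→K-* _ _) (*-congˡ (G≈F x y)) ⟩
      two * F x y
        ≈⟨ solve 8 (λ a b c d e f X Y → con (fromℤ (+ 2)) :* polyFₚ a b c d e f X Y
                     := twicePolyᴷₚ a b c d e f X Y) refl a b c' d e f X Y ⟩
      twicePolyᴷ a b c' d e f X Y
        ≈⟨ twicePolyᴷ-cong X Y ℤ→K-A ℤ→K-B ℤ→K-C ℤ→K-D ℤ→K-E ℤ→K-f₀ ⟨
      twicePolyᴷ (ℤ→K A) (ℤ→K B) (ℤ→K C) (ℤ→K D) (ℤ→K E) (ℤ→K f₀) X Y
        ≡⟨ ≡.cong₂ (twicePolyᴷ (ℤ→K A) (ℤ→K B) (ℤ→K C) (ℤ→K D) (ℤ→K E) (ℤ→K f₀))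
             (ℤ→K-pos x) (ℤ→K-pos y) ⟨
      twicePolyᴷ (ℤ→K A) (ℤ→K B) (ℤ→K C) (ℤ→K D) (ℤ→K E) (ℤ→K f₀) (ℤ→K (+ x)) (ℤ→K (+ y))
        ≈⟨ ℤ→K-twicePoly A B C D E f₀ (+ x) (+ y) ⟨
      ℤ→K (twicePoly A B C D E f₀ (+ x) (+ y)) ∎)
      where
      X = ι (ℕ→ℚ x)
      Y = ι (ℕ→ℚ y)

    quadPart≈ : ∀ x y → quadPart K ι a b c' x y ≈ ι (fromℤ (quadForm A B C (+ x) (+ y)) ℚ.* ½)
    quadPart≈ x y = sym (begin
      ι (fromℤ (quadForm A B C (+ x) (+ y)) ℚ.* ½)
        ≈⟨ ι.*-homo _ ½ ⟩
      ℤ→K (quadForm A B C (+ x) (+ y)) * ι ½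
        ≈⟨ *-congʳ (ℤ→K-quadForm A B C (+ x) (+ y)) ⟩
      quadFormᴷ (ℤ→K A) (ℤ→K B) (ℤ→K C) (ℤ→K (+ x)) (ℤ→K (+ y)) * ι ½
        ≡⟨ ≡.cong₂ (λ X Y → quadFormᴷ (ℤ→K A) (ℤ→K B) (ℤ→K C) X Y * ι ½)
             (ℤ→K-pos x) (ℤ→K-pos y) ⟩
      quadFormᴷ (ℤ→K A) (ℤ→K B) (ℤ→K C) X Y * ι ½
        ≈⟨ *-congʳ (quadFormᴷ-cong X Y ℤ→K-A ℤ→K-B ℤ→K-C) ⟩
      quadFormᴷ a b c' X Y * ι ½
        ≈⟨ solve 5 (λ a b c X Y → quadFormᴷₚ a b c X Y :* con ½
                     := con ½ :* (a :* (X :* X) :+ (b :+ b) :* (X :* Y) :+ c :* (Y :* Y)))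
             refl a b c' X Y ⟩
      quadPart K ι a b c' x y ∎)
      where
      X = ι (ℕ→ℚ x)
      Y = ι (ℕ→ℚ y)

open import Data.Rational using (0ℚ; 1ℚ; ½; _<_; _≤_)
import Data.Rational as ℚ
import Data.Rational.Properties as ℚP

lemma4 : {c ℓ : Level} (K : CommutativeRing c ℓ) (ι : ℚ → CommutativeRing.Carrier K) →
    IsRingHomFromℚ K ι →
    (a b c' d e f : CommutativeRing.Carrier K) →
    ¬ (CommutativeRing._≈_ K a (CommutativeRing.0# K) ×
       CommutativeRing._≈_ K b (CommutativeRing.0# K) ×
       CommutativeRing._≈_ K c' (CommutativeRing.0# K)) →
    (∃ λ (g : ℕ × ℕ → ℕ) → IsBijectionℕ² g ×
       (∀ x y → CommutativeRing._≈_ K (polyF K ι a b c' d e f x y) (ι (ℕ→ℚ (g (x , y)))))) →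
    (∀ (x y : ℕ) → ¬ (x ≡ 0 × y ≡ 0) →
       ∃ λ (q : ℚ) → 0ℚ < q × CommutativeRing._≈_ K (quadPart K ι a b c' x y) (ι q)) ×
    (∃ λ (q : ℚ) → 1ℚ ≤ q × CommutativeRing._≈_ K a (ι q)) ×
    (∃ λ (q : ℚ) → 1ℚ ≤ q × CommutativeRing._≈_ K c' (ι q))
lemma4 K ι ι-hom a b c' d e f not-all-zero (g , (g-injective , _) , F≈g) =
  (λ x y not-origin → fromℤ (quadForm A B C (+ x) (+ y)) ℚ.* ½ ,
     ℚP.*-monoˡ-<-pos ½ (fromℤ-mono-< (quadForm-pos g g-injective A B C D E twice-g x y not-origin)) ,
     quadPart≈ x y) ,
  (fromℤ A , fromℤ-mono-≤ (1≤A g g-injective A B C D E twice-g) , sym ℤ→K-A) ,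
  (fromℤ C , fromℤ-mono-≤ (1≤C g g-injective A B C D E twice-g) , sym ℤ→K-C)
  where
  open CommutativeRing K
  open IntegersInℚ using (fromℤ; fromℤ-mono-<; fromℤ-mono-≤)
  open IntegerQuadratics using (quadForm; quadForm-pos; 1≤A; 1≤C)
  open ℚAlgebra K ι ι-hom using (module Coefficients)
  open import Data.Integer using (+_)

  1≉0 : 1# ≉ 0#
  1≉0 1≈0 = not-all-zero (≈0 a , ≈0 b , ≈0 c')
    where
    ≈0 : ∀ x → x ≈ 0#
    ≈0 x = trans (sym (*-identityʳ x)) (trans (*-congˡ 1≈0) (zeroʳ x))

  open Coefficients 1≉0 a b c' d e f g F≈g
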